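{- Let $\mathfrak{Q}$ be a grounded set system on a finite set $X$ such that $(\mathfrak{Q},\subseteq)$ is a join-semilattice. Then $\mathfrak{Q}$ is a clustering system and there is a DAG $G$ with $\mathfrak{C}_G=\mathfrak{Q}$ that has the global pairwise-lca-property; moreover such a $G$ is a network.
   Context: A set system on $X$ is a subset of $2^X$; it is grounded if $\{x\}\in\mathfrak{Q}$ for all $x\in X$ and $\emptyset\notin\mathfrak{Q}$, and a clustering system if it is grounded and contains $X$. A DAG is a finite directed graph without loops and directed cycles; $u\preceq_G v$ means there is a directed path from $v$ to $u$ (including $u=v$); $L(G)$ is the set of $\preceq_G$-minimal vertices. $C_G(v)=\{x\in L(G):x\preceq_G v\}$, $\mathfrak{C}_G=\{C_G(v):v\in V(G)\}$. A network is a DAG with exactly one $\preceq_G$-maximal vertex. For non-empty $A\subseteq V(G)$, $\mathrm{LCA}_G(A)$ is the set of $\preceq_G$-minimal vertices $v$ with $a\preceq_G v$ for all $a\in A$; $G$ has the global pairwise-lca-property if $|\mathrm{LCA}_G(A)|=1$ for all $A\subseteq V(G)$ with $|A|=2$. A join-semilattice is a poset in which any two elements have a least upper bound. -}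

module Defs where

open import Data.Nat using (ℕ; suc)
open import Data.Fin using (Fin)
open import Data.Fin.Subset using (Subset; _∈_; _⊆_; ⁅_⁆; ⊤; ⊥)
open import Data.Bool using (Bool; true; false)
open import Data.Product using (Σ; ∃; ∃-syntax; _×_)
open import Relation.Binary.PropositionalEquality using (_≡_; _≢_)
open import Relation.Binary.Construct.Closure.ReflexiveTransitive using (Star)
open import Function.Bundles using (_⇔_)
open import Function.Definitions using (Injective)
import Data.Empty as E
import Data.Product

-- A set system on X = Fin k: a (decidable) family of subsets of X,
-- given by its characteristic function on 2^X.
SetSystem : ℕ → Set
SetSystem k = Subset k → Bool

_∈Q_ : ∀ {k} → Subset k → SetSystem k → Set
A ∈Q Q = Q A ≡ true

Grounded : ∀ {k} → SetSystem k → Set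
Grounded Q = (∀ x → ⁅ x ⁆ ∈Q Q) × (Q ⊥ ≡ false)

ClusteringSystem : ∀ {k} → SetSystem k → Set
ClusteringSystem Q = Grounded Q × (⊤ ∈Q Q)

IsJoinSemilattice : ∀ {k} → SetSystem k → Set
IsJoinSemilattice Q =
  ∀ A B → A ∈Q Q → B ∈Q Q →
  ∃[ C ] (C ∈Q Q × A ⊆ C × B ⊆ C ×
          (∀ D → D ∈Q Q → A ⊆ D → B ⊆ D → C ⊆ D))

record Digraph : Set where
  field
    m    : ℕ
    edge : Fin m → Fin m → Bool

module _ (G : Digraph) where
  open Digraph G

  Edge : Fin m → Fin m → Set
  Edge u v = edge u v ≡ true

  -- u ≼ v  iff there is a directed path from v to u (including u = v)
  _≼_ : Fin m → Fin m → Set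
  u ≼ v = Star Edge v u

  Acyclic : Set
  Acyclic = ∀ u v → Edge u v → Star Edge v u → E.⊥

  IsLeaf : Fin m → Set
  IsLeaf v = ∀ u → u ≼ v → u ≡ v

  IsMaximal : Fin m → Set
  IsMaximal r = ∀ v → r ≼ v → v ≡ r

  IsNetwork : Set
  IsNetwork = ∃[ r ] (IsMaximal r × (∀ v → IsMaximal v → v ≡ r))

  IsLCA : Fin m → Fin m → Fin m → Set
  IsLCA u w v = u ≼ v × w ≼ v ×
                (∀ v' → u ≼ v' → w ≼ v' → v' ≼ v → v' ≡ v)

  GlobalPairwiseLCA : Set
  GlobalPairwiseLCA = ∀ u w → u ≢ w →
    ∃[ v ] (IsLCA u w v × (∀ v' → IsLCA u w v' → v' ≡ v))

  -- An identification of X = Fin k with the leaf set L(G):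
  -- an injective map whose image is exactly L(G).
  LeafLabelling : ℕ → Set
  LeafLabelling k = Σ (Fin k → Fin m) λ ℓ →
    Injective _≡_ _≡_ ℓ × (∀ v → IsLeaf v ⇔ (∃[ x ] ℓ x ≡ v))

  IsCluster : ∀ {k} → (Fin k → Fin m) → Fin m → Subset k → Set
  IsCluster ℓ v A = ∀ x → (x ∈ A) ⇔ (ℓ x ≼ v)

  ClustersEq : ∀ {k} → (Fin k → Fin m) → SetSystem k → Set
  ClustersEq ℓ Q = ∀ A → (A ∈Q Q) ⇔ (∃[ v ] IsCluster ℓ v A)

record DAGFor {k : ℕ} (Q : SetSystem k) : Set where
  field
    graph    : Digraph
    acyclic  : Acyclic graph
    labels   : LeafLabelling graph k
    clusters : ClustersEq graph (Data.Product.proj₁ labels) Q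

{-# OPTIONS --safe #-}
-- Take all subsets of X as vertices. Members of Q are ordered by strict inclusion; the
-- other, junk, subsets (present only because vertices are enumerated as Fin m) are stacked
-- above them as a chain. The DAG with an edge for every strict comparability has the
-- singletons as its leaves, and the cluster of a vertex is its own set, or X for a junk
-- vertex (X ∈ Q, being a join of all singletons). Any two vertices have a join in this
-- order (the Q-join of two members, otherwise the higher one), and a join is the unique
-- lca. Conversely, in any DAG climbing from a vertex ends at a maximal one, and two maximal
-- vertices coincide with their lca, so the pairwise-lca property leaves a single root.
module Submission where

open import Defs
open import Data.Nat using (ℕ; suc)
open import Data.Product using (_×_; ∃-syntax)

open import Level using (0ℓ)
open import Data.Nat using (zero; _+_)
open import Data.Fin as Fin using (Fin; zero; _↑ˡ_; _↑ʳ_; splitAt)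
import Data.Fin.Properties as Finₚ
open import Data.Vec using ([]; _∷_)
open import Data.Fin.Subset using (Subset; _∈_; _⊆_; ⁅_⁆; ⊤; inside; outside; Nonempty)
open import Data.Fin.Subset.Properties
  using (⊆-refl; ⊆-trans; ⊆-antisym; _⊆?_; x∈⁅x⁆; x∈⁅y⁆⇒x≡y; nonempty?; Empty-unique; ∈⊤)
open import Data.Bool using (true)
open import Data.Bool.Properties using () renaming (_≟_ to _≟ᵇ_)
open import Data.Product using (∃; _,_; proj₁; proj₂)
open import Data.Sum using (_⊎_; inj₁; inj₂; [_,_])
open import Data.List using (List; []; _∷_; allFin)
open import Data.List.Relation.Unary.Any using (here; there)
open import Data.List.Membership.Propositional using () renaming (_∈_ to _∈ₗ_)
open import Data.List.Membership.Propositional.Properties using (∈-allFin)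
open import Function using (_∘_)
open import Function.Bundles using (_⇔_; mk⇔; Equivalence)
open import Function.Construct.Composition using (_⇔-∘_)
open import Relation.Nullary using (¬_; Dec; yes; no; does; contradiction)
open import Relation.Nullary.Decidable using (dec-true; map′)
open import Relation.Binary
  using (Rel; Reflexive; Irreflexive; Transitive; Decidable; IsDecPartialOrder;
         IsStrictPartialOrder; IsDecStrictPartialOrder; IsPartialOrder; tri<; tri≈; tri>)
open import Relation.Binary.PropositionalEquality
  using (_≡_; refl; sym; trans; cong; subst; isEquivalence)
import Relation.Binary.Construct.StrictToNonStrict as StrictToNonStrict
import Relation.Binary.Construct.NonStrictToStrict as NonStrictToStrict
open import Relation.Binary.Construct.Closure.ReflexiveTransitive using (Star; ε; _◅_; _◅◅_)
open import Induction.WellFounded using (Acc; acc)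
open import Data.Fin.Induction using (spo-wellFounded)

module _ (G : Digraph) (acyclic : Acyclic G) where
  open Digraph G using (m; edge)

  private
    _⇝⁺_ : Fin m → Fin m → Set
    u ⇝⁺ v = ∃[ w ] (Edge G u w × Star (Edge G) w v)

    ⇝⁺-isStrictPartialOrder : IsStrictPartialOrder _≡_ _⇝⁺_
    ⇝⁺-isStrictPartialOrder = record
      { isEquivalence = isEquivalence
      ; irrefl        = λ { refl (w , e , p) → acyclic _ w e p }
      ; trans         = λ { (a , e , p) (b , e′ , q) → a , e , p ◅◅ e′ ◅ q }
      ; <-resp-≈      = (λ { refl p → p }) , (λ { refl p → p })
      }

  no-in-edge⇒IsMaximal : ∀ {r} → (∀ u → ¬ Edge G u r) → IsMaximal G r
  no-in-edge⇒IsMaximal no-in-edge v ε = refl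
  no-in-edge⇒IsMaximal no-in-edge v (e ◅ p) with no-in-edge⇒IsMaximal no-in-edge _ p
  ... | refl = contradiction e (no-in-edge v)

  maximal-above : ∀ v → Acc _⇝⁺_ v → ∃[ r ] IsMaximal G r
  maximal-above v (acc rec) with Finₚ.any? (λ u → edge u v ≟ᵇ true)
  ... | yes (u , e) = maximal-above u (rec (v , e , ε))
  ... | no ∄e       = v , no-in-edge⇒IsMaximal (λ u e → ∄e (u , e))

  GlobalPairwiseLCA⇒IsNetwork : GlobalPairwiseLCA G → Fin m → IsNetwork G
  GlobalPairwiseLCA⇒IsNetwork lca v
    with maximal-above v (spo-wellFounded ⇝⁺-isStrictPartialOrder v)
  ... | r , r-max = r , r-max , unique
    where
    unique : ∀ v → IsMaximal G v → v ≡ r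
    unique v v-max with v Fin.≟ r
    ... | yes v≡r = v≡r
    ... | no v≢r with lca v r v≢r
    ...   | c , (v≼c , r≼c , _) , _ = trans (sym (v-max c v≼c)) (r-max c r≼c)

⁅x⁆⊆⇔∈ : ∀ {k} {x : Fin k} {p} → ⁅ x ⁆ ⊆ p ⇔ x ∈ p
⁅x⁆⊆⇔∈ {x = x} {p} = mk⇔ (λ ⁅x⁆⊆p → ⁅x⁆⊆p (x∈⁅x⁆ x)) x∈p⇒⁅x⁆⊆p
  where
  x∈p⇒⁅x⁆⊆p : x ∈ p → ⁅ x ⁆ ⊆ p
  x∈p⇒⁅x⁆⊆p x∈p y∈⁅x⁆ = subst (_∈ p) (sym (x∈⁅y⁆⇒x≡y x y∈⁅x⁆)) x∈p

∈Q⇒Nonempty : ∀ {k} {Q : SetSystem k} → Grounded Q → ∀ {p} → p ∈Q Q → Nonempty p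
∈Q⇒Nonempty {Q = Q} grounded {p} p∈Q with nonempty? p
... | yes p≠∅ = p≠∅
... | no p=∅ with trans (sym (proj₂ grounded)) (subst (_∈Q Q) (Empty-unique p=∅) p∈Q)
...   | ()

module _ {n} {Q : SetSystem (suc n)} (grounded : Grounded Q) (joins : IsJoinSemilattice Q) where

  covering-member : (xs : List (Fin (suc n))) → ∃[ C ] (C ∈Q Q × (∀ {x} → x ∈ₗ xs → x ∈ C))
  covering-member []       = ⁅ zero ⁆ , proj₁ grounded zero , λ ()
  covering-member (y ∷ ys) with covering-member ys
  ... | C , C∈Q , ys⊆C with joins C ⁅ y ⁆ C∈Q (proj₁ grounded y)
  ...   | D , D∈Q , C⊆D , y⊆D , _ =
    D , D∈Q , λ { (here refl) → y⊆D (x∈⁅x⁆ y) ; (there x∈ys) → C⊆D (ys⊆C x∈ys) }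

  ⊤∈Q : ⊤ ∈Q Q
  ⊤∈Q with covering-member (allFin (suc n))
  ... | C , C∈Q , all⊆C = subst (_∈Q Q) (⊆-antisym (λ _ → ∈⊤) (λ _ → all⊆C (∈-allFin _))) C∈Q

IsCluster-unique : ∀ (G : Digraph) {k} {ℓ : Fin k → Fin (Digraph.m G)} {v A B} →
                   IsCluster G ℓ v A → IsCluster G ℓ v B → A ≡ B
IsCluster-unique G A-cluster B-cluster =
  ⊆-antisym (λ {x} → Equivalence.from (B-cluster x) ∘ Equivalence.to (A-cluster x))
            (λ {x} → Equivalence.from (A-cluster x) ∘ Equivalence.to (B-cluster x))

-- 2 ^ k, unfolded as c + c rather than c + (c + 0) so that splitAt applies directly
subsetCount : ℕ → ℕ
subsetCount zero    = 1
subsetCount (suc k) = subsetCount k + subsetCount k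

encode : ∀ {k} → Subset k → Fin (subsetCount k)
encode []                    = zero
encode {suc k} (outside ∷ p) = encode p ↑ˡ subsetCount k
encode {suc k} (inside ∷ p)  = subsetCount k ↑ʳ encode p

decode : ∀ {k} → Fin (subsetCount k) → Subset k
decode {zero}  _ = []
decode {suc k} i = [ (outside ∷_) ∘ decode {k} , (inside ∷_) ∘ decode {k} ] (splitAt (subsetCount k) i)

decode-encode : ∀ {k} (p : Subset k) → decode (encode p) ≡ p
decode-encode [] = refl
decode-encode {suc k} (outside ∷ p)
  rewrite Finₚ.splitAt-↑ˡ (subsetCount k) (encode p) (subsetCount k) = cong (outside ∷_) (decode-encode p)
decode-encode {suc k} (inside ∷ p)
  rewrite Finₚ.splitAt-↑ʳ (subsetCount k) (subsetCount k) (encode p) = cong (inside ∷_) (decode-encode p)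

encode-decode : ∀ {k} (i : Fin (subsetCount k)) → encode (decode {k} i) ≡ i
encode-decode {zero}  zero = refl
encode-decode {suc k} i with splitAt (subsetCount k) i in eq
... | inj₁ j = trans (cong (_↑ˡ subsetCount k) (encode-decode {k} j)) (Finₚ.splitAt⁻¹-↑ˡ eq)
... | inj₂ j = trans (cong (subsetCount k ↑ʳ_) (encode-decode {k} j)) (Finₚ.splitAt⁻¹-↑ʳ eq)

decode-injective : ∀ {k} {i j : Fin (subsetCount k)} → decode {k} i ≡ decode j → i ≡ j
decode-injective {k} {i} {j} eq =
  trans (sym (encode-decode {k} i)) (trans (cong encode eq) (encode-decode {k} j))

decode-preimage : ∀ {k} (p : Subset k) → ∃[ i ] decode {k} i ≡ p
decode-preimage p = encode p , decode-encode p

IsJoin : ∀ {A : Set} → Rel A 0ℓ → A → A → A → Set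
IsJoin _≤_ x y z = x ≤ z × y ≤ z × (∀ w → x ≤ w → y ≤ w → z ≤ w)

comparable⇒join : ∀ {A : Set} {_≤_ : Rel A 0ℓ} → Reflexive _≤_ →
                  ∀ {x y} → x ≤ y ⊎ y ≤ x → ∃ (IsJoin _≤_ x y)
comparable⇒join ≤-refl (inj₁ x≤y) = _ , x≤y , ≤-refl , λ _ _ y≤w → y≤w
comparable⇒join ≤-refl (inj₂ y≤x) = _ , ≤-refl , y≤x , λ _ x≤w _ → x≤w

module OrderGraph {m : ℕ} {_<_ : Rel (Fin m) 0ℓ}
                  (<-isDecStrictPartialOrder : IsDecStrictPartialOrder _≡_ _<_) where
  open IsDecStrictPartialOrder <-isDecStrictPartialOrder using (_<?_; isStrictPartialOrder; irrefl)
  open StrictToNonStrict _≡_ _<_ public using (_≤_)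
  open IsPartialOrder (StrictToNonStrict.isPartialOrder _≡_ _<_ isStrictPartialOrder) public
    using () renaming (refl to ≤-refl; trans to ≤-trans; antisym to ≤-antisym)

  graph : Digraph
  graph = record { m = m ; edge = λ u v → does (v <? u) }

  Edge⇒> : ∀ {u v} → Edge graph u v → v < u
  Edge⇒> {u} {v} e with v <? u | e
  ... | yes v<u | _  = v<u
  ... | no _    | ()

  ≼⇒≤ : ∀ {u v} → _≼_ graph u v → u ≤ v
  ≼⇒≤ ε       = inj₂ refl
  ≼⇒≤ (e ◅ p) = ≤-trans (≼⇒≤ p) (inj₁ (Edge⇒> e))

  ≤⇒≼ : ∀ {u v} → u ≤ v → _≼_ graph u v
  ≤⇒≼ (inj₁ u<v)  = dec-true (_ <? _) u<v ◅ ε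
  ≤⇒≼ (inj₂ refl) = ε

  acyclic : Acyclic graph
  acyclic u v e v≼u = irrefl (≤-antisym (≼⇒≤ (e ◅ ε)) (≼⇒≤ v≼u)) (Edge⇒> e)

  joins⇒GlobalPairwiseLCA : (∀ u v → ∃ (IsJoin _≤_ u v)) → GlobalPairwiseLCA graph
  joins⇒GlobalPairwiseLCA join u v _ with join u v
  ... | c , u≤c , v≤c , c-least = c , (≤⇒≼ u≤c , ≤⇒≼ v≤c , minimal) , unique
    where
    minimal : ∀ c′ → _≼_ graph u c′ → _≼_ graph v c′ → _≼_ graph c′ c → c′ ≡ c
    minimal c′ u≼c′ v≼c′ c′≼c = ≤-antisym (≼⇒≤ c′≼c) (c-least c′ (≼⇒≤ u≼c′) (≼⇒≤ v≼c′))
    unique : ∀ c′ → IsLCA graph u v c′ → c′ ≡ c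
    unique c′ (u≼c′ , v≼c′ , c′-minimal) =
      sym (c′-minimal c (≤⇒≼ u≤c) (≤⇒≼ v≤c) (≤⇒≼ (c-least c′ (≼⇒≤ u≼c′) (≼⇒≤ v≼c′))))

module Realisation {n : ℕ} (Q : SetSystem (suc n)) where

  Vertex : Set
  Vertex = Fin (subsetCount (suc n))

  subsetOf : Vertex → Subset (suc n)
  subsetOf = decode

  Member : Vertex → Set
  Member v = subsetOf v ∈Q Q

  member? : ∀ v → Dec (Member v)
  member? v = Q (subsetOf v) ≟ᵇ true

  _⊑_ : Rel Vertex 0ℓ
  u ⊑ v = subsetOf u ⊆ subsetOf v

  ⊑-isDecPartialOrder : IsDecPartialOrder _≡_ _⊑_
  ⊑-isDecPartialOrder = record
    { isPartialOrder = record
      { isPreorder = record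
        { isEquivalence = isEquivalence
        ; reflexive     = λ { refl → ⊆-refl }
        ; trans         = ⊆-trans
        }
      ; antisym = λ u⊑v v⊑u → decode-injective {suc n} (⊆-antisym u⊑v v⊑u)
      }
    ; _≟_  = Fin._≟_
    ; _≤?_ = λ u v → subsetOf u ⊆? subsetOf v
    }

  open NonStrictToStrict _≡_ _⊑_ using () renaming (_<_ to _⊏_)
  open IsDecStrictPartialOrder (NonStrictToStrict.<-isDecStrictPartialOrder _≡_ _⊑_ ⊑-isDecPartialOrder)
    using () renaming (irrefl to ⊏-irrefl; trans to ⊏-trans; _<?_ to _⊏?_)

  data _≺_ (u v : Vertex) : Set where
    member≺member : Member u → Member v → u ⊏ v → u ≺ v
    member≺junk   : Member u → ¬ Member v → u ≺ v
    junk≺junk     : ¬ Member u → ¬ Member v → u Fin.< v → u ≺ v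

  ≺-irrefl : Irreflexive _≡_ _≺_
  ≺-irrefl refl (member≺member _ _ u⊏u) = ⊏-irrefl refl u⊏u
  ≺-irrefl refl (member≺junk mu ¬mu)    = ¬mu mu
  ≺-irrefl refl (junk≺junk _ _ u<u)     = Finₚ.<-irrefl refl u<u

  ≺-trans : Transitive _≺_
  ≺-trans (member≺member mu _ u⊏v) (member≺member _ mw v⊏w) = member≺member mu mw (⊏-trans u⊏v v⊏w)
  ≺-trans (member≺member mu _ _)   (member≺junk _ ¬mw)      = member≺junk mu ¬mw
  ≺-trans (member≺junk mu _)       (junk≺junk _ ¬mw _)      = member≺junk mu ¬mw
  ≺-trans (junk≺junk ¬mu _ u<v)    (junk≺junk _ ¬mw v<w)    = junk≺junk ¬mu ¬mw (Finₚ.<-trans u<v v<w)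
  ≺-trans (member≺member _ mv _)   (junk≺junk ¬mv _ _)      = contradiction mv ¬mv
  ≺-trans (member≺junk _ ¬mv)      (member≺member mv _ _)   = contradiction mv ¬mv
  ≺-trans (member≺junk _ ¬mv)      (member≺junk mv _)       = contradiction mv ¬mv
  ≺-trans (junk≺junk _ ¬mv _)      (member≺member mv _ _)   = contradiction mv ¬mv
  ≺-trans (junk≺junk _ ¬mv _)      (member≺junk mv _)       = contradiction mv ¬mv

  _≺?_ : Decidable _≺_
  u ≺? v with member? u | member? v
  ... | yes mu | yes mv = map′ (member≺member mu mv) ⊏-part (u ⊏? v)
    where
    ⊏-part : u ≺ v → u ⊏ v
    ⊏-part (member≺member _ _ u⊏v) = u⊏v
    ⊏-part (member≺junk _ ¬mv)     = contradiction mv ¬mv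
    ⊏-part (junk≺junk ¬mu _ _)     = contradiction mu ¬mu
  ... | yes mu | no ¬mv = yes (member≺junk mu ¬mv)
  ... | no ¬mu | yes mv = no λ
    { (member≺member mu _ _) → ¬mu mu
    ; (member≺junk mu _)     → ¬mu mu
    ; (junk≺junk _ ¬mv _)    → ¬mv mv
    }
  ... | no ¬mu | no ¬mv = map′ (junk≺junk ¬mu ¬mv) <-part (u Fin.<? v)
    where
    <-part : u ≺ v → u Fin.< v
    <-part (member≺member mu _ _) = contradiction mu ¬mu
    <-part (member≺junk mu _)     = contradiction mu ¬mu
    <-part (junk≺junk _ _ u<v)    = u<v

  ≺-isDecStrictPartialOrder : IsDecStrictPartialOrder _≡_ _≺_
  ≺-isDecStrictPartialOrder = record
    { isStrictPartialOrder = record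
      { isEquivalence = isEquivalence
      ; irrefl        = ≺-irrefl
      ; trans         = ≺-trans
      ; <-resp-≈      = (λ { refl u≺v → u≺v }) , (λ { refl u≺v → u≺v })
      }
    ; _≟_  = Fin._≟_
    ; _<?_ = _≺?_
    }

  open OrderGraph ≺-isDecStrictPartialOrder public

  ≤⇔⊑ : ∀ {u v} → Member u → Member v → u ≤ v ⇔ u ⊑ v
  ≤⇔⊑ {u} {v} mu mv = mk⇔ to from
    where
    to : u ≤ v → u ⊑ v
    to (inj₁ (member≺member _ _ (u⊑v , _))) = u⊑v
    to (inj₁ (member≺junk _ ¬mv))           = contradiction mv ¬mv
    to (inj₁ (junk≺junk ¬mu _ _))           = contradiction mu ¬mu
    to (inj₂ refl)                          = ⊆-refl
    from : u ⊑ v → u ≤ v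
    from u⊑v with u Fin.≟ v
    ... | yes u≡v = inj₂ u≡v
    ... | no u≢v  = inj₁ (member≺member mu mv (u⊑v , u≢v))

  member≤junk : ∀ {u v} → Member u → ¬ Member v → u ≤ v
  member≤junk mu ¬mv = inj₁ (member≺junk mu ¬mv)

  junks-comparable : ∀ {u v} → ¬ Member u → ¬ Member v → u ≤ v ⊎ v ≤ u
  junks-comparable {u} {v} ¬mu ¬mv with Finₚ.<-cmp u v
  ... | tri< u<v _ _ = inj₁ (inj₁ (junk≺junk ¬mu ¬mv u<v))
  ... | tri≈ _ u≡v _ = inj₁ (inj₂ u≡v)
  ... | tri> _ _ v<u = inj₂ (inj₁ (junk≺junk ¬mv ¬mu v<u))

  member-join : IsJoinSemilattice Q → ∀ {u v} → Member u → Member v → ∃ (IsJoin _≤_ u v)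
  member-join joins {u} {v} mu mv with joins (subsetOf u) (subsetOf v) mu mv
  ... | C , C∈Q , u⊆C , v⊆C , C-least with decode-preimage C
  ...   | w , refl = w , from (≤⇔⊑ mu C∈Q) u⊆C , from (≤⇔⊑ mv C∈Q) v⊆C , least
    where
    open Equivalence
    least : ∀ z → u ≤ z → v ≤ z → w ≤ z
    least z u≤z v≤z with member? z
    ... | yes mz = from (≤⇔⊑ C∈Q mz) (C-least (subsetOf z) mz (to (≤⇔⊑ mu mz) u≤z) (to (≤⇔⊑ mv mz) v≤z))
    ... | no ¬mz = member≤junk C∈Q ¬mz

  join : IsJoinSemilattice Q → ∀ u v → ∃ (IsJoin _≤_ u v)
  join joins u v with member? u | member? v
  ... | yes mu | yes mv = member-join joins mu mv
  ... | yes mu | no ¬mv = comparable⇒join ≤-refl (inj₁ (member≤junk mu ¬mv))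
  ... | no ¬mu | yes mv = comparable⇒join ≤-refl (inj₂ (member≤junk mv ¬mu))
  ... | no ¬mu | no ¬mv = comparable⇒join ≤-refl (junks-comparable ¬mu ¬mv)

  module _ (grounded : Grounded Q) where
    open Equivalence

    leaf : Fin (suc n) → Vertex
    leaf x = encode ⁅ x ⁆

    leaf-member : ∀ x → Member (leaf x)
    leaf-member x = subst (_∈Q Q) (sym (decode-encode ⁅ x ⁆)) (proj₁ grounded x)

    leaf⊑⇔∈ : ∀ {x v} → leaf x ⊑ v ⇔ x ∈ subsetOf v
    leaf⊑⇔∈ {x} rewrite decode-encode ⁅ x ⁆ = ⁅x⁆⊆⇔∈

    leaf≤⇔∈ : ∀ {x v} → Member v → leaf x ≤ v ⇔ x ∈ subsetOf v
    leaf≤⇔∈ {x} mv = leaf⊑⇔∈ {x} ⇔-∘ ≤⇔⊑ (leaf-member x) mv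

    leaf-below : ∀ v → ∃[ x ] leaf x ≤ v
    leaf-below v with member? v
    ... | yes mv = let x , x∈v = ∈Q⇒Nonempty {Q = Q} grounded mv in x , from (leaf≤⇔∈ mv) x∈v
    ... | no ¬mv = zero , member≤junk (leaf-member zero) ¬mv

    leaf≤leaf⇒≡ : ∀ {x y} → leaf x ≤ leaf y → x ≡ y
    leaf≤leaf⇒≡ {x} {y} ℓx≤ℓy =
      x∈⁅y⁆⇒x≡y y (subst (x ∈_) (decode-encode ⁅ y ⁆) (to (leaf≤⇔∈ (leaf-member y)) ℓx≤ℓy))

    leaf-injective : ∀ {x y} → leaf x ≡ leaf y → x ≡ y
    leaf-injective {x} {y} ℓx≡ℓy = leaf≤leaf⇒≡ {x} {y} (inj₂ ℓx≡ℓy)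

    leaf-minimal : ∀ {u} x → u ≤ leaf x → u ≡ leaf x
    leaf-minimal {u} x u≤ℓx with leaf-below u
    ... | y , ℓy≤u with leaf≤leaf⇒≡ {y} {x} (≤-trans ℓy≤u u≤ℓx)
    ...   | refl = ≤-antisym u≤ℓx ℓy≤u

    IsLeaf⇔leaf : ∀ v → IsLeaf graph v ⇔ (∃[ x ] leaf x ≡ v)
    IsLeaf⇔leaf v = mk⇔ (λ v-leaf → let x , ℓx≤v = leaf-below v in x , v-leaf (leaf x) (≤⇒≼ ℓx≤v))
                        (λ { (x , refl) u u≼ℓx → leaf-minimal x (≼⇒≤ u≼ℓx) })

    member-cluster : ∀ {v} → Member v → IsCluster graph leaf v (subsetOf v)
    member-cluster mv x = mk⇔ (≤⇒≼ ∘ from (leaf≤⇔∈ mv)) (to (leaf≤⇔∈ mv) ∘ ≼⇒≤)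

    junk-cluster : ∀ {v} → ¬ Member v → IsCluster graph leaf v ⊤
    junk-cluster ¬mv x = mk⇔ (λ _ → ≤⇒≼ (member≤junk (leaf-member x) ¬mv)) (λ _ → ∈⊤)

    ∈Q⇒cluster : ∀ {A} → A ∈Q Q → ∃[ v ] IsCluster graph leaf v A
    ∈Q⇒cluster {A} A∈Q with decode-preimage A
    ... | v , refl = v , member-cluster A∈Q

    cluster⇒∈Q : IsJoinSemilattice Q → ∀ {v A} → IsCluster graph leaf v A → A ∈Q Q
    cluster⇒∈Q joins {v} A-cluster with member? v
    ... | yes mv = subst (_∈Q Q) (IsCluster-unique graph (member-cluster mv) A-cluster) mv
    ... | no ¬mv = subst (_∈Q Q) (IsCluster-unique graph (junk-cluster ¬mv) A-cluster) (⊤∈Q grounded joins)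

    realisation : IsJoinSemilattice Q → DAGFor Q
    realisation joins = record
      { graph    = graph
      ; acyclic  = acyclic
      ; labels   = leaf , leaf-injective , IsLeaf⇔leaf
      ; clusters = λ A → mk⇔ ∈Q⇒cluster (λ (v , A-cluster) → cluster⇒∈Q joins A-cluster)
      }

corollary3p8 : (n : ℕ) (Q : SetSystem (suc n)) →
    Grounded Q → IsJoinSemilattice Q →
    ClusteringSystem Q
    × (∃[ G ] GlobalPairwiseLCA (DAGFor.graph {Q = Q} G))
    × (∀ (G : DAGFor Q) → GlobalPairwiseLCA (DAGFor.graph G) → IsNetwork (DAGFor.graph G))
corollary3p8 n Q grounded joins =
    (grounded , ⊤∈Q grounded joins)
  , (realisation grounded joins , joins⇒GlobalPairwiseLCA (join joins))
  , λ G lca → GlobalPairwiseLCA⇒IsNetwork (DAGFor.graph G) (DAGFor.acyclic G) lca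
                                          (proj₁ (DAGFor.labels G) zero)
  where open Realisation Q
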